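{- (i) Suppose there is a function $f:\prod_{X:\mathcal{U}}X\to X$ that is natural under equivalence, a type $X:\mathcal{U}$ and an isolated point $x:X$ with $f_X(x)\neq x$. Then the law of excluded middle holds. (ii) Assuming function extensionality, conversely, if the law of excluded middle holds then there exist a function $f:\prod_{X:\mathcal{U}}X\to X$ natural under equivalence, a type $X:\mathcal{U}$ and an isolated point $x:X$ with $f_X(x)\neq x$.
   Context: Work in intensional Martin-Löf type theory with $\Pi$-, $\Sigma$-, identity, finite types and natural numbers, and a universe $\mathcal{U}$ closed under these. $=$ denotes the identity type, $\neg A$ means $A\to\mathbf{0}$, $a\neq b$ means $\neg(a=b)$, $f_X$ abbreviates $f(X)$. A type is a proposition if any two of its elements are equal. The law of excluded middle: for every proposition $P:\mathcal{U}$, $P+\neg P$. An equivalence is a map with a left and a right inverse. $f:\prod_{X:\mathcal{U}}X\to X$ is natural under equivalence if $e(f_X(x))=f_Y(e(x))$ for all $X,Y:\mathcal{U}$, equivalences $e:X\to Y$ and $x:X$. A point $x:X$ is isolated if $\prod_{y:X}(x=y)+(x\neq y)$. -}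

module Defs where

open import Level using (Level; suc)
open import Data.Product using (Σ; _×_; _,_)
open import Data.Sum using (_⊎_)
open import Relation.Nullary using (¬_)
open import Relation.Binary.PropositionalEquality using (_≡_)

isProp : ∀ {ℓ} → Set ℓ → Set ℓ
isProp A = (a b : A) → a ≡ b

LEM : Set₁
LEM = (P : Set) → isProp P → P ⊎ ¬ P

isEquiv : {X Y : Set} → (X → Y) → Set
isEquiv {X} {Y} e =
  (Σ (Y → X) λ g → (x : X) → g (e x) ≡ x) × (Σ (Y → X) λ h → (y : Y) → e (h y) ≡ y)

NaturalUnderEquiv : ((X : Set) → X → X) → Set₁
NaturalUnderEquiv f =
  (X Y : Set) (e : X → Y) → isEquiv e → (x : X) → e (f X x) ≡ f Y (e x)

isIsolated : {X : Set} → X → Set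
isIsolated {X} x = (y : X) → (x ≡ y) ⊎ ¬ (x ≡ y)

FunExt : Set₁
FunExt = {A : Set} {B : A → Set} {f g : (a : A) → B a} → ((a : A) → f a ≡ g a) → f ≡ g

module Submission where

-- (i) For a proposition P, let Xᴾ = Σ (y : X), D y where D x = ⊤ and D y = P for y ≠ x (a definition by
-- cases that uses only the isolatedness of x). If P holds, the projection Xᴾ → X is an equivalence, so
-- naturality forces f_{Xᴾ} to move (x , tt) off the fibre over x; if f_{Xᴾ} fixes that fibre, P fails, and
-- otherwise the second component of f_{Xᴾ} (x , tt) is a proof of P.
-- (ii) With excluded middle, let f_X x be the other point of X whenever X consists of exactly two points
-- one of which is x, and x itself otherwise. Being such a two-point type is a proposition (by function
-- extensionality and Hedberg's theorem), invariant under equivalence, so the choice is natural; on Bool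
-- it swaps true and false.

open import Defs
open import Axiom.UniquenessOfIdentityProofs using (UIP; module Decidable⇒UIP)
open import Data.Bool using (Bool; true; false)
import Data.Bool.Properties as Bool
open import Data.Empty using (⊥-elim)
open import Data.Product using (Σ; _×_; _,_; proj₁; proj₂)
open import Data.Sum using (_⊎_; inj₁; inj₂)
open import Data.Unit using (⊤; tt)
open import Function using (_∘_)
open import Relation.Binary.Definitions using (DecidableEquality)
open import Relation.Binary.PropositionalEquality
  using (_≡_; refl; sym; trans; cong; cong₂; subst; module ≡-Reasoning)
open import Relation.Nullary using (¬_; yes; no)
open import Relation.Nullary.Decidable using (toSum)

private variable
  A B P X Y : Set

isEquiv⇒inverse : {e : X → Y} → isEquiv e →
                  Σ (Y → X) λ g → ((a : X) → g (e a) ≡ a) × ((b : Y) → e (g b) ≡ b)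
isEquiv⇒inverse {e = e} ((g , g∘e) , (h , e∘h)) = g , g∘e , e∘g
  where
  e∘g : ∀ b → e (g b) ≡ b
  e∘g b = begin
    e (g b)         ≡⟨ cong (e ∘ g) (sym (e∘h b)) ⟩
    e (g (e (h b))) ≡⟨ cong e (g∘e (h b)) ⟩
    e (h b)         ≡⟨ e∘h b ⟩
    b               ∎
    where open ≡-Reasoning

proj₁-isEquiv : {D : X → Set} → (∀ y → isProp (D y)) → (∀ y → D y) → isEquiv (proj₁ {B = D})
proj₁-isEquiv {X} {D} D-prop d = (section , λ { (y , t) → cong (y ,_) (D-prop y (d y) t) })
                               , (section , λ _ → refl)
  where
  section : X → Σ X D
  section y = y , d y

¬-isProp : FunExt → isProp (¬ A)
¬-isProp fe u v = fe λ a → ⊥-elim (u a)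

⊎-isProp : isProp A → isProp B → ¬ (A × B) → isProp (A ⊎ B)
⊎-isProp A-prop _ _ (inj₁ a) (inj₁ a′) = cong inj₁ (A-prop a a′)
⊎-isProp _ B-prop _ (inj₂ b) (inj₂ b′) = cong inj₂ (B-prop b b′)
⊎-isProp _ _ disjoint (inj₁ a) (inj₂ b) = ⊥-elim (disjoint (a , b))
⊎-isProp _ _ disjoint (inj₂ b) (inj₁ a) = ⊥-elim (disjoint (a , b))

decidable⇒isIsolated : DecidableEquality X → (x : X) → isIsolated x
decidable⇒isIsolated _≟_ x y = toSum (x ≟ y)

IfNo : Set → A ⊎ ¬ A → Set
IfNo P (inj₁ _) = ⊤
IfNo P (inj₂ _) = P

IfNo-isProp : isProp P → (d : A ⊎ ¬ A) → isProp (IfNo P d)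
IfNo-isProp P-prop (inj₁ _) _ _ = refl
IfNo-isProp P-prop (inj₂ _) = P-prop

IfNo-inhabited : P → (d : A ⊎ ¬ A) → IfNo P d
IfNo-inhabited p (inj₁ _) = tt
IfNo-inhabited p (inj₂ _) = p

IfNo-yes : A → (d : A ⊎ ¬ A) → IfNo P d
IfNo-yes a (inj₁ _) = tt
IfNo-yes a (inj₂ ¬a) = ⊥-elim (¬a a)

IfNo-no : ¬ A → (d : A ⊎ ¬ A) → IfNo P d → P
IfNo-no ¬a (inj₁ a) _ = ⊥-elim (¬a a)
IfNo-no ¬a (inj₂ _) p = p

module _ (f : (X : Set) → X → X) (nat : NaturalUnderEquiv f)
         {X : Set} {x : X} (x-isolated : isIsolated x) (moved : ¬ f X x ≡ x)
         (P : Set) (P-prop : isProp P) where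

  private
    Xᴾ : Set
    Xᴾ = Σ X λ y → IfNo P (x-isolated y)

    x⋆ : Xᴾ
    x⋆ = x , IfNo-yes refl (x-isolated x)

    naturality : P → proj₁ (f Xᴾ x⋆) ≡ f X x
    naturality p = nat Xᴾ X proj₁ proj₁-equiv x⋆
      where
      proj₁-equiv : isEquiv (proj₁ {B = λ y → IfNo P (x-isolated y)})
      proj₁-equiv = proj₁-isEquiv (IfNo-isProp P-prop ∘ x-isolated) (IfNo-inhabited p ∘ x-isolated)

  decide : P ⊎ ¬ P
  decide with x-isolated (proj₁ (f Xᴾ x⋆))
  ... | inj₁ x≡fx⋆ = inj₂ λ p → moved (trans (sym (naturality p)) (sym x≡fx⋆))
  ... | inj₂ x≢fx⋆ = inj₁ (IfNo-no x≢fx⋆ (x-isolated _) (proj₂ (f Xᴾ x⋆)))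

HasPartner : X → Set
HasPartner {X} x = Σ X λ y → ¬ x ≡ y × ((z : X) → x ≡ z ⊎ y ≡ z)

HasPartner⇒decidable : {x : X} → HasPartner x → DecidableEquality X
HasPartner⇒decidable {x = x} (y , x≢y , cover) a b with cover a | cover b
... | inj₁ x≡a | inj₁ x≡b = yes (trans (sym x≡a) x≡b)
... | inj₂ y≡a | inj₂ y≡b = yes (trans (sym y≡a) y≡b)
... | inj₁ x≡a | inj₂ y≡b = no λ a≡b → x≢y (trans x≡a (trans a≡b (sym y≡b)))
... | inj₂ y≡a | inj₁ x≡b = no λ a≡b → x≢y (trans x≡b (trans (sym a≡b) (sym y≡a)))

HasPartner-isProp : FunExt → (x : X) → isProp (HasPartner x)
HasPartner-isProp {X} fe x q@(y , x≢y , cover) (y′ , x≢y′ , cover′) = same-partner (y≡y′ (cover y′))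
  where
  uip : UIP X
  uip = Decidable⇒UIP.≡-irrelevant (HasPartner⇒decidable q)

  y≡y′ : x ≡ y′ ⊎ y ≡ y′ → y ≡ y′
  y≡y′ (inj₁ x≡y′) = ⊥-elim (x≢y′ x≡y′)
  y≡y′ (inj₂ y≡y′) = y≡y′

  cover-isProp : ∀ z → isProp (x ≡ z ⊎ y ≡ z)
  cover-isProp z = ⊎-isProp uip uip λ (x≡z , y≡z) → x≢y (trans x≡z (sym y≡z))

  same-partner : y ≡ y′ → (y , x≢y , cover) ≡ (y′ , x≢y′ , cover′)
  same-partner refl = cong₂ (λ u v → y , u , v) (¬-isProp fe x≢y x≢y′)
                                               (fe λ z → cover-isProp z (cover z) (cover′ z))

HasPartner-map : (e : X → Y) (g : Y → X) → (∀ a → g (e a) ≡ a) → (∀ b → e (g b) ≡ b) →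
                 {x : X} → HasPartner x → HasPartner (e x)
HasPartner-map e g g∘e e∘g {x} (y , x≢y , cover) = e y , ex≢ey , λ z → cover-image z (cover (g z))
  where
  ex≢ey : ¬ e x ≡ e y
  ex≢ey ex≡ey = x≢y (trans (sym (g∘e x)) (trans (cong g ex≡ey) (g∘e y)))

  cover-image : ∀ z → x ≡ g z ⊎ y ≡ g z → e x ≡ z ⊎ e y ≡ z
  cover-image z (inj₁ x≡gz) = inj₁ (trans (cong e x≡gz) (e∘g z))
  cover-image z (inj₂ y≡gz) = inj₂ (trans (cong e y≡gz) (e∘g z))

other : {x : X} → HasPartner x ⊎ ¬ HasPartner x → X
other (inj₁ (y , _)) = y
other {x = x} (inj₂ _) = x

other-moves : {x : X} → HasPartner x → (d : HasPartner x ⊎ ¬ HasPartner x) → ¬ other d ≡ x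
other-moves _ (inj₁ (y , x≢y , _)) y≡x = x≢y (sym y≡x)
other-moves q (inj₂ ¬q) _ = ¬q q

other-natural : FunExt → (e : X → Y) (g : Y → X) (g∘e : ∀ a → g (e a) ≡ a) (e∘g : ∀ b → e (g b) ≡ b) →
                {x : X} (d : HasPartner x ⊎ ¬ HasPartner x) (d′ : HasPartner (e x) ⊎ ¬ HasPartner (e x)) →
                e (other d) ≡ other d′
other-natural fe e g g∘e e∘g {x} (inj₁ q) (inj₁ q′) =
  cong proj₁ (HasPartner-isProp fe (e x) (HasPartner-map e g g∘e e∘g q) q′)
other-natural fe e g g∘e e∘g (inj₁ q) (inj₂ ¬q′) = ⊥-elim (¬q′ (HasPartner-map e g g∘e e∘g q))
other-natural fe e g g∘e e∘g {x} (inj₂ ¬q) (inj₁ q′) =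
  ⊥-elim (¬q (subst HasPartner (g∘e x) (HasPartner-map g e e∘g g∘e q′)))
other-natural fe e g g∘e e∘g (inj₂ _) (inj₂ _) = refl

true-hasPartner : HasPartner true
true-hasPartner = false , (λ ()) , λ { true → inj₁ refl ; false → inj₂ refl }

module _ (fe : FunExt) (lem : LEM) where

  hasPartner? : {X : Set} (x : X) → HasPartner x ⊎ ¬ HasPartner x
  hasPartner? x = lem (HasPartner x) (HasPartner-isProp fe x)

  swap : (X : Set) → X → X
  swap X x = other (hasPartner? x)

  swap-natural : NaturalUnderEquiv swap
  swap-natural X Y e e-equiv x with isEquiv⇒inverse e-equiv
  ... | g , g∘e , e∘g = other-natural fe e g g∘e e∘g (hasPartner? x) (hasPartner? (e x))

  swap-moves-true : ¬ swap Bool true ≡ true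
  swap-moves-true = other-moves true-hasPartner (hasPartner? true)

theorem2p4 : ((f : (X : Set) → X → X) → NaturalUnderEquiv f → (X : Set) → (x : X) → isIsolated x → ¬ (f X x ≡ x) → LEM)
    × (FunExt → LEM → Σ ((X : Set) → X → X) λ f → NaturalUnderEquiv f × Σ Set λ X → Σ X λ x → isIsolated x × ¬ (f X x ≡ x))
theorem2p4 = (λ f nat X x x-isolated moved → decide f nat x-isolated moved)
           , λ fe lem → swap fe lem , swap-natural fe lem
                      , Bool , true , decidable⇒isIsolated Bool._≟_ true , swap-moves-true fe lem
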